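{- Let $G$ be a graph and let $C\subseteq V(G)$ be a clique in $G$ such that $G$ has no $C$-simple stable cutset. If $G$ has a stable cutset then so does $G-C$.
   Context: All graphs are finite and simple. A stable cutset of a graph $G$ is a set $S\subseteq V(G)$ whose vertices are pairwise non-adjacent and such that $G-S$ is disconnected (has at least two connected components); the empty set is a stable cutset of any disconnected graph. For $W\subseteq V(G)$, $N(W)=\bigcup_{w\in W}N(w)\setminus W$. For a clique $C$, a stable cutset $S$ of $G$ is $C$-simple if $S=N(C)$ or $S=N(C\setminus\{v\})$ for some vertex $v\in C$. -}

module Defs where

open import Data.Nat using (ℕ)
open import Data.Fin using (Fin)
open import Data.Fin.Subset using (Subset; _∈_; _∉_; _∪_) renaming (⊥ to ∅)
open import Data.Product using (Σ; ∃; ∃-syntax; _×_; _,_)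
open import Data.Sum using (_⊎_)
open import Relation.Nullary using (¬_)
open import Relation.Binary using (Decidable)
open import Relation.Binary.PropositionalEquality using (_≡_; _≢_)

record Graph (n : ℕ) : Set₁ where
  field
    Adj     : Fin n → Fin n → Set
    adj?    : Decidable Adj
    sym     : ∀ {u v} → Adj u v → Adj v u
    irrefl  : ∀ {u} → ¬ Adj u u
open Graph public

module _ {n : ℕ} (G : Graph n) where

  data Reach (X : Subset n) : Fin n → Fin n → Set where
    here : ∀ {u} → u ∉ X → Reach X u u
    step : ∀ {u w v} → u ∉ X → Adj G u w → Reach X w v → Reach X u v

  Disconnected-minus : Subset n → Set
  Disconnected-minus X = ∃[ u ] ∃[ v ] (u ∉ X × v ∉ X × ¬ Reach X u v)

  Stable : Subset n → Set
  Stable S = ∀ u v → u ∈ S → v ∈ S → ¬ Adj G u v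

  -- S is a stable cutset of the induced subgraph G - D
  -- (S ⊆ V(G) ∖ D, S stable, and (G - D) - S = G - (D ∪ S) disconnected).
  StableCutsetMinus : Subset n → Subset n → Set
  StableCutsetMinus D S = (∀ v → v ∈ S → v ∉ D) × Stable S × Disconnected-minus (D ∪ S)

  StableCutset : Subset n → Set
  StableCutset S = Stable S × Disconnected-minus S

  Clique : Subset n → Set
  Clique C = ∀ u v → u ∈ C → v ∈ C → u ≢ v → Adj G u v

  InN : (Fin n → Set) → Fin n → Set
  InN W v = ¬ W v × ∃[ w ] (W w × Adj G w v)

  IsN : Subset n → (Fin n → Set) → Set
  IsN S W = ∀ v → (v ∈ S → InN W v) × (InN W v → v ∈ S)

  CSimple : Subset n → Subset n → Set
  CSimple C S = IsN S (_∈ C) ⊎ ∃[ v ] (v ∈ C × IsN S (λ u → u ∈ C × u ≢ v))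

-- Let S be a stable cutset of G separating u from v. If neither u nor v lies in C,
-- then S ∖ C still separates them in G - C. Otherwise, say u ∈ C, and consider
-- T = N(C ∖ S); since S is stable, C ∩ S has at most one vertex, so T is C-simple.
-- If T ⊆ S, then T is stable and separates C ∖ S ∋ u from v, which is excluded.
-- Hence some y ∉ C ∪ S is adjacent to C ∖ S; such a y cannot reach v in G - S
-- (u would reach v through y), so S ∖ C separates y from v in G - C.
module Submission where

open import Defs
open import Data.Nat using (ℕ)
open import Data.Fin using (Fin; _≟_)
open import Data.Fin.Properties using (any?)
open import Data.Fin.Subset using (Subset; _∈_; _∉_; _⊆_; _∪_; _∩_; ∁)
open import Data.Fin.Subset.Properties
  using (_∈?_; x∈p∪q⁺; x∈p∪q⁻; x∈p∩q⁺; x∈p∩q⁻; p∩q⊆p; x∉p⇒x∈∁p; x∈∁p⇒x∉p)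
open import Data.Vec using (tabulate)
open import Data.Vec.Properties using (lookup∘tabulate; lookup⇒[]=; []=⇒lookup)
open import Data.Product using (∃-syntax; _×_; _,_; proj₁; proj₂)
open import Data.Sum using (inj₁; inj₂)
open import Data.Empty using (⊥-elim)
open import Relation.Unary using (Pred; Decidable)
open import Relation.Nullary using (¬_; yes; no; does)
open import Relation.Nullary.Decidable using (_×-dec_; ¬?; dec-true; decidable-stable)
open import Relation.Binary.PropositionalEquality using (refl; trans) renaming (sym to ≡-sym)
open import Function using (_∘_)

private
  variable
    n : ℕ

module _ {ℓ} {P : Pred (Fin n) ℓ} (P? : Decidable P) where

  fromDecidable : Subset n
  fromDecidable = tabulate (λ x → does (P? x))

  ∈-fromDecidable⁺ : ∀ {x} → P x → x ∈ fromDecidable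
  ∈-fromDecidable⁺ {x} px =
    lookup⇒[]= x fromDecidable (trans (lookup∘tabulate _ x) (dec-true (P? x) px))

  ∈-fromDecidable⁻ : ∀ {x} → x ∈ fromDecidable → P x
  ∈-fromDecidable⁻ {x} x∈ with P? x | trans (≡-sym (lookup∘tabulate _ x)) ([]=⇒lookup x∈)
  ... | yes px | _  = px
  ... | no _   | ()

p⊆q∪[p∩∁q] : (p q : Subset n) → p ⊆ q ∪ (p ∩ ∁ q)
p⊆q∪[p∩∁q] p q {x} x∈p with x ∈? q
... | yes x∈q = x∈p∪q⁺ (inj₁ x∈q)
... | no x∉q = x∈p∪q⁺ (inj₂ (x∈p∩q⁺ (x∈p , x∉p⇒x∈∁p x∉q)))

x∉q∪[p∩∁q] : (p q : Subset n) {x : Fin n} → x ∉ p → x ∉ q → x ∉ q ∪ (p ∩ ∁ q)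
x∉q∪[p∩∁q] p q x∉p x∉q x∈ with x∈p∪q⁻ q (p ∩ ∁ q) x∈
... | inj₁ x∈q = x∉q x∈q
... | inj₂ x∈p∩∁q = x∉p (p∩q⊆p p (∁ q) x∈p∩∁q)

module _ (G : Graph n) where

  Reach-start∉ : ∀ {X a b} → Reach G X a b → a ∉ X
  Reach-start∉ (here a∉X) = a∉X
  Reach-start∉ (step a∉X _ _) = a∉X

  Reach-antimono : ∀ {X Y a b} → X ⊆ Y → Reach G Y a b → Reach G X a b
  Reach-antimono X⊆Y (here a∉Y) = here (a∉Y ∘ X⊆Y)
  Reach-antimono X⊆Y (step a∉Y a~w w⇝b) =
    step (a∉Y ∘ X⊆Y) a~w (Reach-antimono X⊆Y w⇝b)

  Reach-snoc : ∀ {X a b c} → Reach G X a b → Adj G b c → c ∉ X → Reach G X a c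
  Reach-snoc (here a∉X) a~c c∉X = step a∉X a~c (here c∉X)
  Reach-snoc (step a∉X a~w w⇝b) b~c c∉X = step a∉X a~w (Reach-snoc w⇝b b~c c∉X)

  Reach-sym : ∀ {X a b} → Reach G X a b → Reach G X b a
  Reach-sym (here a∉X) = here a∉X
  Reach-sym (step a∉X a~w w⇝b) = Reach-snoc (Reach-sym w⇝b) (sym G a~w) a∉X

  Reach-preserves : ∀ {ℓ} {W : Pred (Fin n) ℓ} {X a b} →
                    (∀ {x y} → W x → Adj G x y → y ∉ X → W y) →
                    Reach G X a b → W a → W b
  Reach-preserves closed (here _) Wa = Wa
  Reach-preserves closed (step _ a~w w⇝b) Wa =
    Reach-preserves closed w⇝b (closed Wa a~w (Reach-start∉ w⇝b))

  Reach-via-clique : ∀ {C X a b w} → Clique G C → a ∈ C → b ∈ C → a ∉ X →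
                     Reach G X b w → Reach G X a w
  Reach-via-clique {a = a} {b} clique a∈C b∈C a∉X b⇝w with a ≟ b
  ... | yes refl = b⇝w
  ... | no a≢b = step a∉X (clique a b a∈C b∈C a≢b) b⇝w

  Stable-⊆ : ∀ {S T} → T ⊆ S → Stable G S → Stable G T
  Stable-⊆ T⊆S stable x y x∈T y∈T = stable x y (T⊆S x∈T) (T⊆S y∈T)

  stableCutsetMinus-S∩∁C : ∀ {C S x y} → Stable G S → x ∉ C → y ∉ C → x ∉ S → y ∉ S →
                           ¬ Reach G S x y → StableCutsetMinus G C (S ∩ ∁ C)
  stableCutsetMinus-S∩∁C {C} {S} {x} {y} stable x∉C y∉C x∉S y∉S x↮y =
    (λ _ z∈S∩∁C → x∈∁p⇒x∉p (proj₂ (x∈p∩q⁻ S (∁ C) z∈S∩∁C))) ,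
    Stable-⊆ (p∩q⊆p S (∁ C)) stable ,
    x , y , x∉q∪[p∩∁q] S C x∉S x∉C , x∉q∪[p∩∁q] S C y∉S y∉C ,
    x↮y ∘ Reach-antimono (p⊆q∪[p∩∁q] S C)

  module _ {W : Fin n → Set} where

    IsN-exists : Decidable W → ∃[ T ] IsN G T W
    IsN-exists W? = fromDecidable InN? , λ x → ∈-fromDecidable⁻ InN? , ∈-fromDecidable⁺ InN?
      where
      InN? : Decidable (InN G W)
      InN? y = ¬? (W? y) ×-dec any? (λ x → W? x ×-dec adj? G x y)

    IsN-cong : ∀ {W′ : Fin n → Set} {T} → (∀ {x} → W x → W′ x) → (∀ {x} → W′ x → W x) →
               IsN G T W → IsN G T W′
    IsN-cong W⇒W′ W′⇒W N y =
      (λ y∈T → let ¬Wy , x , Wx , x~y = proj₁ (N y) y∈T in (¬Wy ∘ W′⇒W) , x , W⇒W′ Wx , x~y)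
      , λ (¬W′y , x , W′x , x~y) → proj₂ (N y) ((¬W′y ∘ W⇒W′) , x , W′⇒W W′x , x~y)

    IsN-∉ : ∀ {T x} → IsN G T W → W x → x ∉ T
    IsN-∉ N Wx x∈T = proj₁ (proj₁ (N _) x∈T) Wx

    IsN-separates : ∀ {T u v} → Decidable W → IsN G T W → W u → ¬ W v → ¬ Reach G T u v
    IsN-separates {T} W? N Wu ¬Wv u⇝v = ¬Wv (Reach-preserves closed u⇝v Wu)
      where
      closed : ∀ {x y} → W x → Adj G x y → y ∉ T → W y
      closed {x} {y} Wx x~y y∉T =
        decidable-stable (W? y) (λ ¬Wy → y∉T (proj₂ (N y) (¬Wy , x , Wx , x~y)))

  module _ {C S : Subset n} (clique : Clique G C) (stable : Stable G S) where

    C∖S : Fin n → Set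
    C∖S x = x ∈ C × x ∉ S

    C∖S? : Decidable C∖S
    C∖S? x = x ∈? C ×-dec ¬? (x ∈? S)

    IsN-C∖S-CSimple : ∀ {T} → IsN G T C∖S → CSimple G C T
    IsN-C∖S-CSimple N with any? (λ x → x ∈? C ×-dec x ∈? S)
    ... | no C∩S≡∅ =
      inj₁ (IsN-cong proj₁ (λ x∈C → x∈C , λ x∈S → C∩S≡∅ (_ , x∈C , x∈S)) N)
    ... | yes (x , x∈C , x∈S) =
      inj₂ (x , x∈C , IsN-cong
        (λ (y∈C , y∉S) → y∈C , λ { refl → y∉S x∈S })
        (λ (y∈C , y≢x) → y∈C , λ y∈S → stable _ x y∈S x∈S (clique _ x y∈C x∈C y≢x))
        N)

    escape-from-clique : (∀ T → StableCutset G T → ¬ CSimple G C T) →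
                         ∀ {u v} → u ∈ C → v ∉ C → u ∉ S → v ∉ S → ¬ Reach G S u v →
                         ∃[ y ] (y ∉ C × y ∉ S × ¬ Reach G S y v)
    escape-from-clique noCSimple {u} {v} u∈C v∉C u∉S v∉S u↮v
      with IsN-exists C∖S?
    ... | T , N with any? (λ y → y ∈? T ×-dec ¬? (y ∈? S))
    ...   | yes (y , y∈T , y∉S) =
      let ¬C∖Sy , c , (c∈C , c∉S) , c~y = proj₁ (N y) y∈T in
      y , (λ y∈C → ¬C∖Sy (y∈C , y∉S)) , y∉S ,
      λ y⇝v → u↮v (Reach-via-clique clique u∈C c∈C u∉S (step c∉S c~y y⇝v))
    ...   | no T⊈S = ⊥-elim (noCSimple T T-stableCutset (IsN-C∖S-CSimple N))
      where
      T⊆S : T ⊆ S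
      T⊆S {y} y∈T = decidable-stable (y ∈? S) (λ y∉S → T⊈S (y , y∈T , y∉S))

      T-stableCutset : StableCutset G T
      T-stableCutset =
        Stable-⊆ T⊆S stable ,
        u , v , IsN-∉ N (u∈C , u∉S) , (λ v∈T → v∉S (T⊆S v∈T)) ,
        IsN-separates C∖S? N (u∈C , u∉S) (λ (v∈C , _) → v∉C v∈C)

lemma3 : (n : ℕ) (G : Graph n) (C : Subset n) →
           Clique G C →
           (∀ S → StableCutset G S → ¬ CSimple G C S) →
           (∃[ S ] StableCutset G S) →
           ∃[ S ] StableCutsetMinus G C S
lemma3 n G C clique noCSimple (S , stable , u , v , u∉S , v∉S , u↮v) with u ∈? C | v ∈? C
... | yes u∈C | yes v∈C = ⊥-elim (u↮v (Reach-via-clique G clique u∈C v∈C u∉S (here v∉S)))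
... | yes u∈C | no v∉C =
  let y , y∉C , y∉S , y↮v =
        escape-from-clique G clique stable noCSimple u∈C v∉C u∉S v∉S u↮v
  in S ∩ ∁ C , stableCutsetMinus-S∩∁C G stable y∉C v∉C y∉S v∉S y↮v
... | no u∉C | yes v∈C =
  let y , y∉C , y∉S , y↮u =
        escape-from-clique G clique stable noCSimple v∈C u∉C v∉S u∉S (u↮v ∘ Reach-sym G)
  in S ∩ ∁ C , stableCutsetMinus-S∩∁C G stable y∉C u∉C y∉S u∉S y↮u
... | no u∉C | no v∉C = S ∩ ∁ C , stableCutsetMinus-S∩∁C G stable u∉C v∉C u∉S v∉S u↮v
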